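{- Let $n\ge 3$ be an integer. For every integer $p\ge 1$ let $\mathtt A_p=[a_{ij}]_{1\le i,j\le p}\in\{0,1\}^{p\times p}$ be defined by $a_{ij}=1$ iff $j=i+1$ or $i+j=p+1$, and let $P_p(\lambda)=\det(\mathtt A_p-\lambda I)$. Let $\mathtt B_n=[b_{ij}]_{0\le i,j\le n}\in\{0,1\}^{(n+1)\times(n+1)}$ be defined by $b_{ij}=1$ iff ($i=0$ and $j=0$) or ($i=n$ and $j=0$) or $j=i+1$ or $i+j=n+1$, and let $Q_n(\lambda)=\det(\mathtt B_n-\lambda I)$. Then $$Q_n(\lambda)=\lambda^2P_{n-2}(\lambda)-\lambda P_n(\lambda).$$
   Context: $\mathtt A_p$ is the adjacency matrix of the relation "$\nabla_j\circ\nabla_i$ is meaningful" among the differential operations $\nabla_1,\dots,\nabla_p$ of vector analysis on $\mathbb R^p$, and $\mathtt B_n$ is the analogous matrix for $\nabla_0,\nabla_1,\dots,\nabla_n$ where $\nabla_0$ is the Gateaux directional derivative; only the explicit matrix definitions above are needed. -}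

module Defs where

open import Level using (Level)
open import Algebra.Bundles using (CommutativeRing)
open import Data.Nat using (ℕ; zero; suc)
open import Data.Fin using (Fin; zero; suc; toℕ; punchIn)
open import Data.Bool using (Bool; true; false; if_then_else_; _∨_; _∧_)
open import Relation.Nullary.Decidable using (⌊_⌋)
import Data.Nat as ℕ
import Data.Fin as F

_==_ : ℕ → ℕ → Bool
m == n = ⌊ m ℕ.≟ n ⌋

module _ {c ℓ : Level} (R : CommutativeRing c ℓ) where
  open CommutativeRing R using (Carrier; _+_; _*_; -_; _-_; 0#; 1#)

  sumFin : ∀ n → (Fin n → Carrier) → Carrier
  sumFin zero f = 0#
  sumFin (suc n) f = f zero + sumFin n (λ i → f (suc i))

  sign : ℕ → Carrier
  sign zero = 1#
  sign (suc k) = - sign k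

  det : ∀ n → (Fin n → Fin n → Carrier) → Carrier
  det zero M = 1#
  det (suc n) M =
    sumFin (suc n) (λ j → sign (toℕ j) * (M zero j * det n (λ i k → M (suc i) (punchIn j k))))

  fromBool : Bool → Carrier
  fromBool true = 1#
  fromBool false = 0#

  charMat : ∀ {n} → (Fin n → Fin n → Carrier) → Carrier → Fin n → Fin n → Carrier
  charMat M x i j = M i j - (if ⌊ i F.≟ j ⌋ then x else 0#)

  -- A_p = [a_ij]_{1≤i,j≤p}; the Fin index i represents the paper's index toℕ i ℕ.+ 1.
  -- a_ij = 1 iff j = i+1 or i+j = p+1.
  A : (p : ℕ) → Fin p → Fin p → Carrier
  A p i j = fromBool (((toℕ j ℕ.+ 1) == ((toℕ i ℕ.+ 1) ℕ.+ 1)) ∨ (((toℕ i ℕ.+ 1) ℕ.+ (toℕ j ℕ.+ 1)) == (p ℕ.+ 1)))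

  -- B_n = [b_ij]_{0≤i,j≤n}; the Fin (n+1) index i represents the paper's index toℕ i.
  -- b_ij = 1 iff (i=0 ∧ j=0) or (i=n ∧ j=0) or j=i+1 or i+j=n+1.
  B : (n : ℕ) → Fin (suc n) → Fin (suc n) → Carrier
  B n i j = fromBool
    (((toℕ i == 0) ∧ (toℕ j == 0)) ∨ ((toℕ i == n) ∧ (toℕ j == 0))
      ∨ (toℕ j == (toℕ i ℕ.+ 1)) ∨ ((toℕ i ℕ.+ toℕ j) == (n ℕ.+ 1)))

  P : ℕ → Carrier → Carrier
  P p x = det p (charMat (A p) x)

  Q : ℕ → Carrier → Carrier
  Q n x = det (suc n) (charMat (B n) x)

module Submission where

-- Expand det (B_n − λI) along row 0, whose only nonzero entries are 1 − λ and 1. Deleting row 0 and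
-- column 0 leaves A_n − λI. Columns 0 and 1 of B_n − λI agree below row 1, and in row 1 they read 0
-- and −λ; so deleting column 1 instead leaves a matrix that differs from A_n − λI only in its corner
-- entry, and its determinant is P_n + λ det C, where C is B_n − λI without rows and columns 0, 1.
-- The last row of C is (0, …, 0, −λ) and deleting it leaves A_{n−2} − λI, so det C = −λ P_{n−2}.
-- Hence Q_n = (1 − λ) P_n − (P_n − λ² P_{n−2}).

open import Defs
open import Algebra.Bundles using (CommutativeRing)
open import Data.Nat using (ℕ; zero; suc; _≤_; _<_; _∸_; _≡ᵇ_; s≤s)
import Data.Nat as ℕ
open import Data.Bool using (Bool; true; false; T; if_then_else_; _∨_; _∧_)
open import Data.Bool.Properties using (∧-comm; ∨-identityʳ; ¬-not; T-≡)
open import Data.Fin as Fin using (Fin; zero; suc; toℕ; punchIn; inject₁; fromℕ)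
open import Data.Fin.Properties using (toℕ-inject₁; toℕ-fromℕ; toℕ<n)
open import Data.Nat.Properties using (≡ᵇ⇒≡; ≡⇒≡ᵇ; <⇒≢; >⇒≢; m≤m+n)
import Data.Nat.Properties as ℕₚ
open import Data.Unit using (tt)
open import Function using (_∘_; Equivalence)
import Relation.Binary.PropositionalEquality as ≡
open ≡ using (_≡_; _≢_)
open import Relation.Nullary.Decidable using (⌊_⌋; does; isYes≗does)
import Algebra.Properties.AbelianGroup as AbelianGroupProperties
import Algebra.Properties.CommutativeSemigroup as CommutativeSemigroupProperties
import Algebra.Properties.Ring as RingProperties
import Algebra.Properties.Semiring.Sum as SemiringSum
import Relation.Binary.Reasoning.Setoid as SetoidReasoning

punchIn-fromℕ : ∀ {n} (j : Fin n) → punchIn (fromℕ n) j ≡ inject₁ j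
punchIn-fromℕ zero    = ≡.refl
punchIn-fromℕ (suc j) = ≡.cong suc (punchIn-fromℕ j)

punchIn-inject₁ : ∀ {n} (j : Fin (suc n)) (k : Fin n) → punchIn (inject₁ j) (inject₁ k) ≡ inject₁ (punchIn j k)
punchIn-inject₁ zero    k       = ≡.refl
punchIn-inject₁ (suc j) zero    = ≡.refl
punchIn-inject₁ (suc j) (suc k) = ≡.cong suc (punchIn-inject₁ j k)

punchIn-inject₁-fromℕ : ∀ {n} (j : Fin (suc n)) → punchIn (inject₁ j) (fromℕ n) ≡ fromℕ (suc n)
punchIn-inject₁-fromℕ         zero    = ≡.refl
punchIn-inject₁-fromℕ {suc n} (suc j) = ≡.cong suc (punchIn-inject₁-fromℕ j)

module Determinant {c ℓ} (R : CommutativeRing c ℓ) where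

  open CommutativeRing R hiding (zero)
  open SemiringSum semiring using (sum; sum-cong-≋; sum-replicate-zero; sum-init-last; *-distribˡ-sum)
  open RingProperties ring using (-1*x≈-x)
  open SetoidReasoning setoid
  module +-CS = CommutativeSemigroupProperties +-commutativeSemigroup
  module *-CS = CommutativeSemigroupProperties *-commutativeSemigroup

  Matrix : ℕ → Set c
  Matrix n = Fin n → Fin n → Carrier

  minor : ∀ {n} → Matrix (suc n) → Fin (suc n) → Matrix n
  minor M j i k = M (suc i) (punchIn j k)

  cofactor : ∀ {n} → Matrix (suc n) → Fin (suc n) → Carrier
  cofactor {n} M j = sign R (toℕ j) * (M zero j * det R n (minor M j))

  sumFin≡sum : ∀ n (f : Fin n → Carrier) → sumFin R n f ≡ sum f
  sumFin≡sum zero    f = ≡.refl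
  sumFin≡sum (suc n) f = ≡.cong (f zero +_) (sumFin≡sum n (f ∘ suc))

  det-suc : ∀ n (M : Matrix (suc n)) → det R (suc n) M ≡ sum (cofactor M)
  det-suc n M = sumFin≡sum (suc n) (cofactor M)

  sum-zero : ∀ {n} {f : Fin n → Carrier} → (∀ i → f i ≈ 0#) → sum f ≈ 0#
  sum-zero {n} f≈0 = trans (sum-cong-≋ f≈0) (sum-replicate-zero n)

  det-cong : ∀ n {M N : Matrix n} → (∀ i j → M i j ≈ N i j) → det R n M ≈ det R n N
  det-cong zero    M≈N = refl
  det-cong (suc n) {M} {N} M≈N = begin
    det R (suc n) M      ≡⟨ det-suc n M ⟩
    sum (cofactor M)     ≈⟨ sum-cong-≋ (λ j → *-congˡ {sign R (toℕ j)} (*-cong (M≈N zero j) (det-cong n (λ i k → M≈N (suc i) (punchIn j k))))) ⟩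
    sum (cofactor N)     ≡⟨ det-suc n N ⟨
    det R (suc n) N      ∎

  det-perturb₀₀ : ∀ n {M M′ : Matrix (suc n)} {d} →
                  M zero zero ≈ M′ zero zero + d →
                  (∀ j → M zero (suc j) ≈ M′ zero (suc j)) →
                  (∀ i j → M (suc i) j ≈ M′ (suc i) j) →
                  det R (suc n) M ≈ det R (suc n) M′ + d * det R n (minor M zero)
  det-perturb₀₀ n {M} {M′} {d} M₀₀≈M′₀₀+d row₀ rows = begin
    det R (suc n) M                        ≡⟨ det-suc n M ⟩
    sum (cofactor M)                       ≈⟨ +-cong (*-identityˡ _) (sum-cong-≋ cofactors) ⟩
    M zero zero * D + S′                   ≈⟨ +-congʳ (*-congʳ M₀₀≈M′₀₀+d) ⟩
    (M′ zero zero + d) * D + S′            ≈⟨ +-congʳ (distribʳ D (M′ zero zero) d) ⟩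
    (M′ zero zero * D + d * D) + S′        ≈⟨ +-CS.xy∙z≈xz∙y _ _ _ ⟩
    (M′ zero zero * D + S′) + d * D        ≈⟨ +-congʳ (+-congʳ cofactor₀) ⟩
    sum (cofactor M′) + d * D              ≡⟨ ≡.cong (_+ d * D) (det-suc n M′) ⟨
    det R (suc n) M′ + d * D               ∎
    where
    D  = det R n (minor M zero)
    S′ = sum (cofactor M′ ∘ suc)
    minors : ∀ j → det R n (minor M j) ≈ det R n (minor M′ j)
    minors j = det-cong n (λ i k → rows i (punchIn j k))
    cofactors : ∀ j → cofactor M (suc j) ≈ cofactor M′ (suc j)
    cofactors j = *-congˡ {sign R (toℕ (suc j))} (*-cong (row₀ j) (minors (suc j)))
    cofactor₀ : M′ zero zero * D ≈ cofactor M′ zero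
    cofactor₀ = trans (*-congˡ (minors zero)) (sym (*-identityˡ _))

  det-lastRow : ∀ n (M : Matrix (suc n)) → (∀ k → M (fromℕ n) (inject₁ k) ≈ 0#) →
                det R (suc n) M ≈ M (fromℕ n) (fromℕ n) * det R n (λ i k → M (inject₁ i) (inject₁ k))
  det-lastRow zero    M _ = trans (+-identityʳ _) (*-identityˡ _)
  det-lastRow (suc n) M lastRow = begin
    det R (suc (suc n)) M                                       ≡⟨ det-suc (suc n) M ⟩
    sum (cofactor M)                                            ≈⟨ sum-init-last (cofactor M) ⟩
    sum (cofactor M ∘ inject₁) + cofactor M (fromℕ (suc n))     ≈⟨ +-cong (sum-cong-≋ cofactors) lastCofactor ⟩
    sum (λ j → a * cofactor L j) + 0#                           ≈⟨ +-identityʳ _ ⟩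
    sum (λ j → a * cofactor L j)                                ≈⟨ *-distribˡ-sum a (cofactor L) ⟨
    a * sum (cofactor L)                                        ≡⟨ ≡.cong (a *_) (det-suc n L) ⟨
    a * det R (suc n) L                                         ∎
    where
    a = M (fromℕ (suc n)) (fromℕ (suc n))
    L : Matrix (suc n)
    L i k = M (inject₁ i) (inject₁ k)
    cofactors : ∀ j → cofactor M (inject₁ j) ≈ a * cofactor L j
    cofactors j = trans
      (*-cong (reflexive (≡.cong (sign R) (toℕ-inject₁ j)))
        (*-congˡ (trans
          (det-lastRow n (minor M (inject₁ j))
            (λ k → trans (reflexive (≡.cong (M (fromℕ (suc n))) (punchIn-inject₁ j k))) (lastRow (punchIn j k))))
          (*-cong (reflexive (≡.cong (M (fromℕ (suc n))) (punchIn-inject₁-fromℕ j)))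
            (det-cong n (λ i k → reflexive (≡.cong (M (suc (inject₁ i))) (punchIn-inject₁ j k))))))))
      (*-pull _ _ a _)
      where
      *-pull : ∀ s b c e → s * (b * (c * e)) ≈ c * (s * (b * e))
      *-pull s b c e = trans (*-congˡ (*-CS.x∙yz≈y∙xz b c e)) (*-CS.x∙yz≈y∙xz s c (b * e))
    lastCofactor : cofactor M (fromℕ (suc n)) ≈ 0#
    lastCofactor = trans (*-congˡ (trans (*-congˡ minorVanishes) (zeroʳ _))) (zeroʳ _)
      where
      onLastRow : ∀ k → M (fromℕ (suc n)) (punchIn (fromℕ (suc n)) k) ≈ 0#
      onLastRow k = trans (reflexive (≡.cong (M (fromℕ (suc n))) (punchIn-fromℕ k))) (lastRow k)
      minorVanishes : det R (suc n) (minor M (fromℕ (suc n))) ≈ 0#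
      minorVanishes = trans (det-lastRow n (minor M (fromℕ (suc n))) (onLastRow ∘ inject₁)) (trans (*-congʳ (onLastRow (fromℕ n))) (zeroˡ _))

  det-firstRow₂ : ∀ n (M : Matrix (suc (suc n))) → (∀ j → M zero (suc (suc j)) ≈ 0#) →
                  det R (suc (suc n)) M ≈
                  M zero zero * det R (suc n) (minor M zero) - M zero (suc zero) * det R (suc n) (minor M (suc zero))
  det-firstRow₂ n M row₀ = begin
    det R (suc (suc n)) M                              ≡⟨ det-suc (suc n) M ⟩
    cofactor M zero + (cofactor M (suc zero) + sum (λ j → cofactor M (suc (suc j))))
      ≈⟨ +-cong (*-identityˡ _) (+-cong (-1*x≈-x _) (sum-zero farCofactor)) ⟩
    M zero zero * D₀ + (- (M zero (suc zero) * D₁) + 0#)   ≈⟨ +-congˡ (+-identityʳ _) ⟩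
    M zero zero * D₀ - M zero (suc zero) * D₁             ∎
    where
    D₀ = det R (suc n) (minor M zero)
    D₁ = det R (suc n) (minor M (suc zero))
    farCofactor : ∀ j → cofactor M (suc (suc j)) ≈ 0#
    farCofactor j = trans (*-congˡ {sign R (toℕ (suc (suc j)))} (trans (*-congʳ (row₀ j)) (zeroˡ _))) (zeroʳ _)

==⇒≡ᵇ : ∀ m n → (m == n) ≡ (m ≡ᵇ n)
==⇒≡ᵇ m n = isYes≗does (m ℕ.≟ n)

≟-Fin⇒≡ᵇ : ∀ {n} (i j : Fin n) → ⌊ i Fin.≟ j ⌋ ≡ (toℕ i ≡ᵇ toℕ j)
≟-Fin⇒≡ᵇ i j = ≡.trans (isYes≗does (i Fin.≟ j)) (does-≟ i j)
  where
  does-≟ : ∀ {n} (i j : Fin n) → does (i Fin.≟ j) ≡ (toℕ i ≡ᵇ toℕ j)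
  does-≟ zero    zero    = ≡.refl
  does-≟ zero    (suc j) = ≡.refl
  does-≟ (suc i) zero    = ≡.refl
  does-≟ (suc i) (suc j) = does-≟ i j

≡ᵇ-refl : ∀ n → (n ≡ᵇ n) ≡ true
≡ᵇ-refl n = Equivalence.to T-≡ (≡⇒≡ᵇ n n ≡.refl)

≢⇒≡ᵇ-false : ∀ {m n} → m ≢ n → (m ≡ᵇ n) ≡ false
≢⇒≡ᵇ-false {m} {n} m≢n = ¬-not (λ eq → m≢n (≡ᵇ⇒≡ m n (≡.subst T (≡.sym eq) tt)))

-- The entry patterns of A_p and B_n on 0-based indices (index a of A_p is the paper's a + 1).
a-pattern : ℕ → ℕ → ℕ → Bool
a-pattern p a b = (b ≡ᵇ suc a) ∨ (suc (a ℕ.+ b) ≡ᵇ p)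

b-pattern : ℕ → ℕ → ℕ → Bool
b-pattern n a b = ((b ≡ᵇ 0) ∧ (a ≡ᵇ 0)) ∨ ((b ≡ᵇ 0) ∧ (a ≡ᵇ n)) ∨ (b ≡ᵇ suc a) ∨ (a ℕ.+ b ≡ᵇ suc n)

a-pattern-suc-suc : ∀ p a b → a-pattern (suc (suc p)) (suc a) (suc b) ≡ a-pattern p a b
a-pattern-suc-suc p a b = ≡.cong (λ s → (b ≡ᵇ suc a) ∨ (s ≡ᵇ p)) (ℕₚ.+-suc a b)

b-pattern-suc-suc : ∀ n a b → b-pattern n (suc a) (suc b) ≡ a-pattern n a b
b-pattern-suc-suc n a b = ≡.cong (λ s → (b ≡ᵇ suc a) ∨ (s ≡ᵇ n)) (ℕₚ.+-suc a b)

b-pattern-row₀ : ∀ m b → b < suc m → b-pattern (suc (suc m)) 0 (suc (suc b)) ≡ false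
b-pattern-row₀ m b b<m = ≢⇒≡ᵇ-false (<⇒≢ b<m)

b-pattern-column₁≡column₀ : ∀ m a → a < suc m → b-pattern (suc (suc m)) (suc (suc a)) 1 ≡ b-pattern (suc (suc m)) (suc (suc a)) 0
b-pattern-column₁≡column₀ m a a<m rewrite ℕₚ.+-comm a 1 | ℕₚ.+-identityʳ a | ≢⇒≡ᵇ-false (<⇒≢ a<m) =
  ≡.sym (∨-identityʳ (a ≡ᵇ m))

a-pattern-lastRow : ∀ m b → b < suc m → a-pattern m m b ≡ false
a-pattern-lastRow m b b<m rewrite ≢⇒≡ᵇ-false (<⇒≢ b<m) = ≢⇒≡ᵇ-false (>⇒≢ (s≤s (m≤m+n m b)))

A-bool≡a-pattern : ∀ p a b → (((b ℕ.+ 1) == ((a ℕ.+ 1) ℕ.+ 1)) ∨ (((a ℕ.+ 1) ℕ.+ (b ℕ.+ 1)) == (p ℕ.+ 1))) ≡ a-pattern p a b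
A-bool≡a-pattern p a b
  rewrite ==⇒≡ᵇ (b ℕ.+ 1) (a ℕ.+ 1 ℕ.+ 1) | ==⇒≡ᵇ (a ℕ.+ 1 ℕ.+ (b ℕ.+ 1)) (p ℕ.+ 1)
        | ℕₚ.+-comm (a ℕ.+ 1) 1 | ℕₚ.+-comm a 1 | ℕₚ.+-comm b 1 | ℕₚ.+-comm p 1 | ℕₚ.+-suc a b = ≡.refl

B-bool≡b-pattern : ∀ n a b → (((a == 0) ∧ (b == 0)) ∨ ((a == n) ∧ (b == 0)) ∨ (b == (a ℕ.+ 1)) ∨ ((a ℕ.+ b) == (n ℕ.+ 1))) ≡ b-pattern n a b
B-bool≡b-pattern n a b
  rewrite ==⇒≡ᵇ a 0 | ==⇒≡ᵇ b 0 | ==⇒≡ᵇ a n | ==⇒≡ᵇ b (a ℕ.+ 1) | ==⇒≡ᵇ (a ℕ.+ b) (n ℕ.+ 1)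
        | ℕₚ.+-comm a 1 | ℕₚ.+-comm n 1 | ∧-comm (a ≡ᵇ 0) (b ≡ᵇ 0) | ∧-comm (a ≡ᵇ n) (b ≡ᵇ 0) = ≡.refl

module _ {c ℓ} (R : CommutativeRing c ℓ) where

  open CommutativeRing R hiding (zero)
  open RingProperties ring using ([y-z]x≈yx-zx; -0#≈0#; -‿distribˡ-*; -‿distribʳ-*; -‿involutive)
  open AbelianGroupProperties +-abelianGroup using (xyx⁻¹≈y)
  open SetoidReasoning setoid
  open Determinant R

  -x*-y≈x*y : ∀ a b → - a * - b ≈ a * b
  -x*-y≈x*y a b = trans (sym (-‿distribˡ-* a (- b))) (trans (-‿cong (sym (-‿distribʳ-* a b))) (-‿involutive _))

  recurrence-algebra : ∀ x p q d → p ≈ d + - x * (- x * q) → (1# - x) * p - 1# * d ≈ x * x * q - x * p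
  recurrence-algebra x p q d p≈d+e = begin
    (1# - x) * p - 1# * d         ≈⟨ +-cong ([y-z]x≈yx-zx p 1# x) (-‿cong (*-identityˡ d)) ⟩
    (1# * p - x * p) - d          ≈⟨ +-congʳ (+-congʳ (trans (*-identityˡ p) p≈d+e)) ⟩
    ((d + e) - x * p) - d         ≈⟨ +-congʳ (+-assoc d e (- (x * p))) ⟩
    (d + (e - x * p)) - d         ≈⟨ xyx⁻¹≈y d (e - x * p) ⟩
    e - x * p                     ≈⟨ +-congʳ e≈x*x*q ⟩
    x * x * q - x * p             ∎
    where
    e = - x * (- x * q)
    e≈x*x*q : e ≈ x * x * q
    e≈x*x*q = trans (*-congˡ (sym (-‿distribˡ-* x q))) (trans (-x*-y≈x*y x (x * q)) (sym (*-assoc x x q)))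

  charEntry : Carrier → Bool → Bool → Carrier
  charEntry x adjacent diagonal = fromBool R adjacent - (if diagonal then x else 0#)

  charMat-A : ∀ p x (i j : Fin p) → charMat R (A R p) x i j ≡ charEntry x (a-pattern p (toℕ i) (toℕ j)) (toℕ i ≡ᵇ toℕ j)
  charMat-A p x i j = ≡.cong₂ (charEntry x) (A-bool≡a-pattern p (toℕ i) (toℕ j)) (≟-Fin⇒≡ᵇ i j)

  charMat-B : ∀ n x (i j : Fin (suc n)) → charMat R (B R n) x i j ≡ charEntry x (b-pattern n (toℕ i) (toℕ j)) (toℕ i ≡ᵇ toℕ j)
  charMat-B n x i j = ≡.cong₂ (charEntry x) (B-bool≡b-pattern n (toℕ i) (toℕ j)) (≟-Fin⇒≡ᵇ i j)

  module _ (m : ℕ) (x : Carrier) where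

    Bₓ : Matrix (suc (suc (suc m)))
    Bₓ = charMat R (B R (suc (suc m))) x

    Bₓ-entry : ∀ i j → Bₓ i j ≡ charEntry x (b-pattern (suc (suc m)) (toℕ i) (toℕ j)) (toℕ i ≡ᵇ toℕ j)
    Bₓ-entry = charMat-B (suc (suc m)) x

    Bₓ-row₀ : ∀ j → Bₓ zero (suc (suc j)) ≈ 0#
    Bₓ-row₀ j = trans
      (reflexive (≡.trans (Bₓ-entry zero (suc (suc j))) (≡.cong (λ β → charEntry x β false) (b-pattern-row₀ m (toℕ j) (toℕ<n j)))))
      (-‿inverseʳ 0#)

    Bₓ₀₁≈1 : Bₓ zero (suc zero) ≈ 1#
    Bₓ₀₁≈1 = trans (reflexive (Bₓ-entry zero (suc zero))) (trans (+-congˡ -0#≈0#) (+-identityʳ 1#))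

    Bₓ₁₁≈Bₓ₁₀-x : Bₓ (suc zero) (suc zero) ≈ Bₓ (suc zero) zero - x
    Bₓ₁₁≈Bₓ₁₀-x = begin
      Bₓ (suc zero) (suc zero)     ≡⟨ Bₓ-entry (suc zero) (suc zero) ⟩
      0# - x                       ≈⟨ +-congʳ (-‿inverseʳ 0#) ⟨
      (0# - 0#) - x                ≡⟨ ≡.cong (_- x) (Bₓ-entry (suc zero) zero) ⟨
      Bₓ (suc zero) zero - x       ∎

    Bₓ-column₁≈column₀ : ∀ i → Bₓ (suc (suc i)) (suc zero) ≈ Bₓ (suc (suc i)) zero
    Bₓ-column₁≈column₀ i = reflexive (≡.trans (Bₓ-entry (suc (suc i)) (suc zero))
      (≡.trans (≡.cong (λ β → charEntry x β false) (b-pattern-column₁≡column₀ m (toℕ i) (toℕ<n i)))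
               (≡.sym (Bₓ-entry (suc (suc i)) zero))))

    minor₀≈minor₁-belowRow₀ : ∀ i k → minor Bₓ zero (suc i) k ≈ minor Bₓ (suc zero) (suc i) k
    minor₀≈minor₁-belowRow₀ i zero    = Bₓ-column₁≈column₀ i
    minor₀≈minor₁-belowRow₀ i (suc k) = refl

    minor₀≈A : ∀ i k → minor Bₓ zero i k ≈ charMat R (A R (suc (suc m))) x i k
    minor₀≈A i k = reflexive (≡.trans (Bₓ-entry (suc i) (suc k))
      (≡.trans (≡.cong (λ β → charEntry x β (toℕ i ≡ᵇ toℕ k)) (b-pattern-suc-suc (suc (suc m)) (toℕ i) (toℕ k)))
               (≡.sym (charMat-A (suc (suc m)) x i k))))

    C : Matrix (suc m)
    C = minor (minor Bₓ zero) zero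

    C-entry : ∀ a b → (i : Fin (suc m)) (k : Fin (suc m)) → toℕ i ≡ a → toℕ k ≡ b → C i k ≡ charEntry x (a-pattern m a b) (a ≡ᵇ b)
    C-entry a b i k ≡.refl ≡.refl = ≡.trans (Bₓ-entry (suc (suc i)) (suc (suc k)))
      (≡.cong (λ β → charEntry x β (a ≡ᵇ b)) (≡.trans (b-pattern-suc-suc (suc (suc m)) (suc a) (suc b)) (a-pattern-suc-suc m a b)))

    C-lastRow : ∀ k → C (fromℕ m) (inject₁ k) ≈ 0#
    C-lastRow k = trans
      (reflexive (≡.trans (C-entry m (toℕ k) (fromℕ m) (inject₁ k) (toℕ-fromℕ m) (toℕ-inject₁ k))
        (≡.cong₂ (charEntry x) (a-pattern-lastRow m (toℕ k) (ℕₚ.m<n⇒m<1+n (toℕ<n k))) (≢⇒≡ᵇ-false (>⇒≢ (toℕ<n k))))))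
      (-‿inverseʳ 0#)

    C-last≈-x : C (fromℕ m) (fromℕ m) ≈ - x
    C-last≈-x = trans
      (reflexive (≡.trans (C-entry m m (fromℕ m) (fromℕ m) (toℕ-fromℕ m) (toℕ-fromℕ m))
        (≡.cong₂ (charEntry x) (a-pattern-lastRow m m (ℕₚ.n<1+n m)) (≡ᵇ-refl m))))
      (+-identityˡ (- x))

    C-topLeft : ∀ i k → C (inject₁ i) (inject₁ k) ≈ charMat R (A R m) x i k
    C-topLeft i k = reflexive (≡.trans (C-entry (toℕ i) (toℕ k) (inject₁ i) (inject₁ k) (toℕ-inject₁ i) (toℕ-inject₁ k))
      (≡.sym (charMat-A m x i k)))

    det-C : det R (suc m) C ≈ - x * P R m x
    det-C = trans (det-lastRow m C C-lastRow) (*-cong C-last≈-x (det-cong m C-topLeft))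

  Q-recurrence : ∀ m x → Q R (suc (suc m)) x ≈ x * x * P R m x - x * P R (suc (suc m)) x
  Q-recurrence m x = begin
    Q R (suc (suc m)) x                                       ≈⟨ det-firstRow₂ (suc m) (Bₓ m x) (Bₓ-row₀ m x) ⟩
    Bₓ m x zero zero * D₀ - Bₓ m x zero (suc zero) * D₁       ≈⟨ +-cong (*-congˡ D₀≈p) (-‿cong (*-congʳ (Bₓ₀₁≈1 m x))) ⟩
    (1# - x) * p - 1# * D₁                                    ≈⟨ recurrence-algebra x p q D₁ p≈D₁+x²q ⟩
    x * x * q - x * p                                         ∎
    where
    p = P R (suc (suc m)) x
    q = P R m x
    D₀ = det R (suc (suc m)) (minor (Bₓ m x) zero)
    D₁ = det R (suc (suc m)) (minor (Bₓ m x) (suc zero))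
    D₀≈p : D₀ ≈ p
    D₀≈p = det-cong (suc (suc m)) (minor₀≈A m x)
    p≈D₁+x²q : p ≈ D₁ + - x * (- x * q)
    p≈D₁+x²q = begin
      p                                           ≈⟨ D₀≈p ⟨
      D₀                                          ≈⟨ det-perturb₀₀ (suc m) {minor (Bₓ m x) zero} {minor (Bₓ m x) (suc zero)} (Bₓ₁₁≈Bₓ₁₀-x m x) (λ _ → refl) (minor₀≈minor₁-belowRow₀ m x) ⟩
      D₁ + - x * det R (suc m) (C m x)            ≈⟨ +-congˡ (*-congˡ (det-C m x)) ⟩
      D₁ + - x * (- x * q)                        ∎

lemma4p2 : ∀ {c ℓ} (R : CommutativeRing c ℓ) (n : ℕ) → 3 ≤ n →
    let open CommutativeRing R in
    (x : Carrier) → Q R n x ≈ (x * x) * P R (n ∸ 2) x - x * P R n x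
lemma4p2 R (suc (suc (suc k))) (s≤s (s≤s (s≤s _))) = Q-recurrence R (suc k)
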